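{- Let $M=(V,D)$ be a proper set system and let $Y\subseteq V$. Then \[ Q(M+Y)=\sum_{(A,B,C)\in\mathcal{P}_3(V)} a_A\, b_{B\oplus Y'}\, c_{C\oplus Y'}\, y^{d_{M*B\,\bar{*}\,C}}\quad\text{with } Y'=Y\setminus A,\] \[ Q(M\,\bar{*}\,Y)=\sum_{(A,B,C)\in\mathcal{P}_3(V)} a_{A\oplus Y'}\, b_{B}\, c_{C\oplus Y'}\, y^{d_{M*B\,\bar{*}\,C}}\quad\text{with } Y'=Y\setminus B,\] \[ Q(M*Y)=\sum_{(A,B,C)\in\mathcal{P}_3(V)} a_{A\oplus Y'}\, b_{B\oplus Y'}\, c_{C}\, y^{d_{M*B\,\bar{*}\,C}}\quad\text{with } Y'=Y\setminus C.\]
   Context: A set system is a pair $M=(V,D)$ with $V$ a finite set and $D$ a family of subsets of $V$; we write $Z\in M$ for $Z\in D$. $M$ is proper if $D\neq\emptyset$. $\oplus$ denotes symmetric difference (of sets, and of families of sets). For $X\subseteq V$, the pivot is $M*X=(V,\{Z\oplus X: Z\in D\})$. For $u\in V$, loop complementation is $M+u=(V,\,D\oplus\{Z\cup\{u\}: Z\in D,\ u\notin Z\})$. Operations are applied left to right (e.g. $M+u*u$ means $(M+u)*u$). The dual pivot is $M\,\bar{*}\,u = M+u*u+u$. Operations on distinct elements commute, so for $X\subseteq V$, $M+X$ and $M\,\bar{*}\,X$ denote applying $+u$ (resp. $\bar{*}\,u$) for each $u\in X$. For proper $M$ and $X\subseteq V$, $d_M(X)=\min\{|X\oplus Z|: Z\in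 M\}$ and $d_M=d_M(\emptyset)$. $\mathcal{P}_3(V)$ is the set of ordered triples $(A,B,C)$ of pairwise disjoint subsets of $V$ (possibly empty) with $A\cup B\cup C=V$. The multivariate interlace polynomial is $Q(M)=\sum_{(A,B,C)\in\mathcal{P}_3(V)} a_A b_B c_C\, y^{d_{M*B\,\bar{*}\,C}}$, where $y$ and the $a_S,b_S,c_S$ ($S\subseteq V$) are indeterminates. -}

module Defs where

open import Level using (Level)
open import Data.Bool.Base using (Bool; true; false; if_then_else_; _xor_; _∧_)
open import Data.Nat.Base using (ℕ; zero; suc; _⊓_)
open import Data.Fin.Base using (Fin)
open import Data.Fin.Subset using (Subset; ⁅_⁆; _∪_; _─_; _-_; ∣_∣)
import Data.Fin.Subset as Sub
open import Data.Vec.Base using (Vec; []; _∷_; zipWith; lookup)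
open import Data.List.Base using (List; []; _∷_; map; _++_; filter; foldr; concatMap)
open import Data.Product.Base using (_×_; _,_; Σ)
open import Relation.Binary.PropositionalEquality using (_≡_)
open import Relation.Nullary.Decidable.Core using (does)
open import Data.Bool.Properties using () renaming (_≟_ to _≟B_)
open import Algebra.Bundles using (CommutativeRing)

infixl 6 _⊕_
_⊕_ : ∀ {n} → Subset n → Subset n → Subset n
_⊕_ = zipWith _xor_

-- A set system (V, D) on V = Fin n, with D given by its characteristic
-- function: Z ∈ M  iff  M Z ≡ true.
SetSystem : ℕ → Set
SetSystem n = Subset n → Bool

_∈M_ : ∀ {n} → Subset n → SetSystem n → Set
Z ∈M M = M Z ≡ true

Proper : ∀ {n} → SetSystem n → Set
Proper {n} M = Σ (Subset n) λ Z → Z ∈M M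

-- Pivot: M ⋆ X (paper: M * X) = (V, {Z ⊕ X : Z ∈ D}), i.e. Z ∈ M ⋆ X iff Z ⊕ X ∈ M.
infixl 5 _⋆_
_⋆_ : ∀ {n} → SetSystem n → Subset n → SetSystem n
(M ⋆ X) Z = M (Z ⊕ X)

-- Loop complementation: M + u = (V, D ⊕ {Z ∪ {u} : Z ∈ D, u ∉ Z}).
-- Z belongs to the second family iff u ∈ Z and Z - u ∈ D.
infixl 5 _+_
_+_ : ∀ {n} → SetSystem n → Fin n → SetSystem n
(M + u) Z = M Z xor (lookup Z u ∧ M (Z - u))

infixl 5 _*̄_
_*̄_ : ∀ {n} → SetSystem n → Fin n → SetSystem n
M *̄ u = M + u ⋆ ⁅ u ⁆ + u

-- Apply an elementwise operation for every element of X.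
-- (Operations on distinct elements commute, so the order is immaterial.)
allFinL : ∀ n → List (Fin n)
allFinL zero = []
allFinL (suc n) = Fin.zero ∷ map Fin.suc (allFinL n)

applyAll : ∀ {n} → (SetSystem n → Fin n → SetSystem n) →
           SetSystem n → Subset n → SetSystem n
applyAll {n} op M X =
  foldr (λ u N → if lookup X u then op N u else N) M (allFinL n)

infixl 5 _+ˢ_ _*̄ˢ_
_+ˢ_ : ∀ {n} → SetSystem n → Subset n → SetSystem n
_+ˢ_ = applyAll _+_

_*̄ˢ_ : ∀ {n} → SetSystem n → Subset n → SetSystem n
_*̄ˢ_ = applyAll _*̄_

allSubsets : ∀ n → List (Subset n)
allSubsets zero = [] ∷ []
allSubsets (suc n) = map (true ∷_) (allSubsets n) ++ map (false ∷_) (allSubsets n)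

-- Minimum of a list of naturals (0 for the empty list; never used on
-- empty lists for proper set systems).
minimum : List ℕ → ℕ
minimum [] = 0
minimum (x ∷ []) = x
minimum (x ∷ y ∷ xs) = x ⊓ minimum (y ∷ xs)

dist : ∀ {n} → SetSystem n → Subset n → ℕ
dist {n} M X = minimum (map (λ Z → ∣ X ⊕ Z ∣) (filter (λ Z → M Z ≟B true) (allSubsets n)))

d : ∀ {n} → SetSystem n → ℕ
d M = dist M Sub.⊥

P3 : ∀ n → List (Subset n × Subset n × Subset n)
P3 zero = ([] , [] , []) ∷ []
P3 (suc n) = concatMap
  (λ { (A , B , C) → (true ∷ A , false ∷ B , false ∷ C)
                   ∷ (false ∷ A , true ∷ B , false ∷ C)
                   ∷ (false ∷ A , false ∷ B , true ∷ C) ∷ [] })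
  (P3 n)

module _ {c ℓ : Level} (R : CommutativeRing c ℓ) where
  open CommutativeRing R renaming (_+_ to _+R_; _*_ to _*R_)

  pow : Carrier → ℕ → Carrier
  pow x zero = 1#
  pow x (suc k) = x *R pow x k

  sumP3 : ∀ {n} → (Subset n → Subset n → Subset n → Carrier) → Carrier
  sumP3 {n} f = foldr (λ { (A , B , C) s → f A B C +R s }) 0# (P3 n)

  Q : ∀ {n} → (a b cc : Subset n → Carrier) → Carrier → SetSystem n → Carrier
  Q a b cc y M = sumP3 λ A B C → a A *R b B *R cc C *R pow y (d (M ⋆ B *̄ˢ C))

-- Identify a set system with the characteristic function of D, a vector over GF(2).
-- Then +u, *u and *̄u are linear, and they only see the element u: splitting a set
-- system on {u} ∪ V' into its two fibres (sets avoiding u, sets containing u), the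
-- operation at u mixes the fibres by a 2×2 matrix over GF(2), while operations at the
-- other elements act on both fibres alike. So two words of operations agree as soon as
-- their matrices agree at every element. For an ordered partition (A, B, C) this gives
-- M + Y * (B ⊕ Y') *̄ (C ⊕ Y') = M * B *̄ C + Y with Y' = Y ∖ A, and similarly
-- M *̄ Y * B *̄ (C ⊕ Y') = M * B *̄ C + (Y ∩ B) and M * Y * (B ⊕ Y') *̄ C = M * B *̄ C + (Y ∩ C).
-- Loop complementation does not change d, since it only adds or removes sets that
-- properly contain a member of smaller size. Finally (A, B, C) ↦ (A, B ⊕ Y', C ⊕ Y')
-- (and its two analogues) is a bijection of P₃(V), so the sums can be re-indexed.

module Submission where

open import Defs
open import Level using (Level)
open import Data.Nat.Base using (ℕ; zero; suc; _≤_; _<_)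
open import Data.Nat.Properties using (≤-antisym; ≤-trans; ≤-refl; <⇒≤; ≤-<-trans; <-irrefl; m⊓n≤m; m⊓n≤n; ⊓-sel)
open import Data.Bool.Base using (Bool; true; false; if_then_else_; _xor_; _∧_)
open import Data.Bool.Properties
  using (xor-same; xor-comm; xor-assoc; xor-identityʳ; ∧-distribˡ-xor; ∧-distribʳ-xor; xor-∧-commutativeRing)
  renaming (_≟_ to _≟B_)
open import Data.Fin.Base using (Fin) renaming (zero to fz; suc to fs)
open import Data.Fin.Subset using (Subset; _─_; _∩_; ⁅_⁆; ∣_∣; _-_)
import Data.Fin.Subset as Sub
open import Data.Fin.Subset.Properties using (p─⊥≡p; x∈p⇒∣p-x∣<∣p∣)
open import Data.Vec.Base using ([]; _∷_; lookup)
open import Data.Vec.Properties using (lookup⇒[]=; zipWith-identityˡ; zipWith-identityʳ)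
open import Data.List.Base using (List; []; _∷_; map; foldr; foldl; filter; concatMap)
open import Data.List.Membership.Propositional using (_∈_)
open import Data.List.Membership.Propositional.Properties using (∈-++⁺ˡ; ∈-++⁺ʳ; ∈-map⁺; ∈-map∘filter⁺; ∈-map∘filter⁻)
open import Data.List.Relation.Unary.Any using (here; there)
open import Data.Product.Base using (Σ; _×_; _,_)
open import Data.Sum.Base using (_⊎_; inj₁; inj₂)
open import Data.Unit.Base using (⊤; tt)
open import Data.Empty using (⊥; ⊥-elim)
open import Algebra.Bundles using (CommutativeRing)
import Algebra.Properties.CommutativeSemigroup as CommutativeSemigroupProperties
open import Relation.Binary.PropositionalEquality using (_≡_; refl; sym; trans; cong; cong₂; subst; module ≡-Reasoning)

xor-interchange : ∀ a b c e → (a xor b) xor (c xor e) ≡ (a xor c) xor (b xor e)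
xor-interchange = CommutativeSemigroupProperties.interchange
  (CommutativeRing.+-commutativeSemigroup xor-∧-commutativeRing)

⊕-identityˡ : ∀ {n} (Z : Subset n) → Sub.⊥ ⊕ Z ≡ Z
⊕-identityˡ = zipWith-identityˡ λ _ → refl

⊕-identityʳ : ∀ {n} (Z : Subset n) → Z ⊕ Sub.⊥ ≡ Z
⊕-identityʳ = zipWith-identityʳ xor-identityʳ

⊕-cancelʳ : ∀ {n} (Z X : Subset n) → (Z ⊕ X) ⊕ X ≡ Z
⊕-cancelʳ [] [] = refl
⊕-cancelʳ (z ∷ Z) (x ∷ X) = cong₂ _∷_ xor-cancelʳ (⊕-cancelʳ Z X)
  where
    open ≡-Reasoning
    xor-cancelʳ : (z xor x) xor x ≡ z
    xor-cancelʳ = begin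
      (z xor x) xor x ≡⟨ xor-assoc z x x ⟩
      z xor (x xor x) ≡⟨ cong (z xor_) (xor-same x) ⟩
      z xor false     ≡⟨ xor-identityʳ z ⟩
      z               ∎

-- Set systems as a vector space over GF(2)

infix 4 _≐_
_≐_ : ∀ {n} → SetSystem n → SetSystem n → Set
N ≐ N' = ∀ Z → N Z ≡ N' Z

≐-sym : ∀ {n} {N N' : SetSystem n} → N ≐ N' → N' ≐ N
≐-sym e Z = sym (e Z)

infixl 6 _⊻_
_⊻_ : ∀ {n} → SetSystem n → SetSystem n → SetSystem n
(N ⊻ N') Z = N Z xor N' Z

record Linear {n} (F : SetSystem n → SetSystem n) : Set where
  field
    cong-≐ : ∀ {N N'} → N ≐ N' → F N ≐ F N'
    ⊻-homo : ∀ N N' → F (N ⊻ N') ≐ F N ⊻ F N'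
open Linear

linear-id : ∀ {n} → Linear {n} (λ N → N)
linear-id = record { cong-≐ = λ e → e ; ⊻-homo = λ _ _ _ → refl }

linear-∘ : ∀ {n} {F G : SetSystem n → SetSystem n} → Linear F → Linear G → Linear (λ N → G (F N))
linear-∘ {F = F} linF linG = record
  { cong-≐ = λ e → cong-≐ linG (cong-≐ linF e)
  ; ⊻-homo = λ N N' Z → trans (cong-≐ linG (⊻-homo linF N N') Z) (⊻-homo linG (F N) (F N') Z)
  }

linear-if : ∀ {n} {F : SetSystem n → SetSystem n} b → Linear F → Linear (λ N → if b then F N else N)
linear-if true linF = linF
linear-if false _ = linear-id

linear-+ : ∀ {n} (u : Fin n) → Linear (λ N → N + u)
linear-+ u = record
  { cong-≐ = λ e Z → cong₂ (λ p q → p xor (lookup Z u ∧ q)) (e Z) (e (Z - u))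
  ; ⊻-homo = λ N N' Z →
      trans (cong ((N Z xor N' Z) xor_) (∧-distribˡ-xor (lookup Z u) (N (Z - u)) (N' (Z - u))))
            (xor-interchange (N Z) (N' Z) _ _)
  }

linear-⋆ : ∀ {n} (X : Subset n) → Linear (λ N → N ⋆ X)
linear-⋆ X = record { cong-≐ = λ e Z → e (Z ⊕ X) ; ⊻-homo = λ _ _ _ → refl }

linear-*̄ : ∀ {n} (u : Fin n) → Linear (λ N → N *̄ u)
linear-*̄ u = linear-∘ (linear-∘ (linear-+ u) (linear-⋆ ⁅ u ⁆)) (linear-+ u)

step : ∀ {n} → (SetSystem n → Fin n → SetSystem n) → Subset n → Fin n → SetSystem n → SetSystem n
step op X u N = if lookup X u then op N u else N

linear-applyAll : ∀ {n} (op : SetSystem n → Fin n → SetSystem n) →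
  (∀ u → Linear (λ N → op N u)) → ∀ X → Linear (λ N → applyAll op N X)
linear-applyAll {n} op linOp X = go (allFinL n)
  where
    go : ∀ L → Linear (λ N → foldr (step op X) N L)
    go [] = linear-id
    go (u ∷ L) = linear-∘ (go L) (linear-if (lookup X u) (linOp u))

-- Coordinatewise action: 2×2 matrices over GF(2)

-- The linear form (a , b) ↦ α a + β b; evaluating it by cases makes the forms of the
-- identity and the swap matrix evaluate to a and b definitionally.
record Form : Set where
  constructor form
  field
    α β : Bool

⟦_⟧ : Form → Bool → Bool → Bool
⟦ form false false ⟧ a b = false
⟦ form true  false ⟧ a b = a
⟦ form false true  ⟧ a b = b
⟦ form true  true  ⟧ a b = a xor b

⟦form⟧ : ∀ α β a b → ⟦ form α β ⟧ a b ≡ (α ∧ a) xor (β ∧ b)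
⟦form⟧ false false a b = refl
⟦form⟧ true  false a b = sym (xor-identityʳ a)
⟦form⟧ false true  a b = refl
⟦form⟧ true  true  a b = refl

infixl 6 _+ᶠ_
_+ᶠ_ : Form → Form → Form
form α β +ᶠ form α' β' = form (α xor α') (β xor β')

infixl 7 _·ᶠ_
_·ᶠ_ : Bool → Form → Form
γ ·ᶠ form α β = form (γ ∧ α) (γ ∧ β)

⟦+ᶠ⟧ : ∀ f g a b → ⟦ f +ᶠ g ⟧ a b ≡ ⟦ f ⟧ a b xor ⟦ g ⟧ a b
⟦+ᶠ⟧ (form α β) (form α' β') a b = begin
  ⟦ form (α xor α') (β xor β') ⟧ a b
    ≡⟨ ⟦form⟧ (α xor α') (β xor β') a b ⟩
  ((α xor α') ∧ a) xor ((β xor β') ∧ b)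
    ≡⟨ cong₂ _xor_ (∧-distribʳ-xor a α α') (∧-distribʳ-xor b β β') ⟩
  ((α ∧ a) xor (α' ∧ a)) xor ((β ∧ b) xor (β' ∧ b))
    ≡⟨ xor-interchange (α ∧ a) (α' ∧ a) (β ∧ b) (β' ∧ b) ⟩
  ((α ∧ a) xor (β ∧ b)) xor ((α' ∧ a) xor (β' ∧ b))
    ≡⟨ sym (cong₂ _xor_ (⟦form⟧ α β a b) (⟦form⟧ α' β' a b)) ⟩
  ⟦ form α β ⟧ a b xor ⟦ form α' β' ⟧ a b
    ∎
  where open ≡-Reasoning

⟦·ᶠ⟧ : ∀ γ f a b → ⟦ γ ·ᶠ f ⟧ a b ≡ γ ∧ ⟦ f ⟧ a b
⟦·ᶠ⟧ true  (form α β) a b = refl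
⟦·ᶠ⟧ false (form α β) a b = refl

record Mat : Set where
  constructor mat
  field
    row₀ row₁ : Form

row : Mat → Bool → Form
row K false = Mat.row₀ K
row K true  = Mat.row₁ K

infixl 7 _∘ᶠ_ _·ᴹ_
_∘ᶠ_ : Form → Mat → Form
form α β ∘ᶠ K = α ·ᶠ row K false +ᶠ β ·ᶠ row K true

_·ᴹ_ : Mat → Mat → Mat
L ·ᴹ K = mat (row L false ∘ᶠ K) (row L true ∘ᶠ K)

row-·ᴹ : ∀ L K h → row (L ·ᴹ K) h ≡ row L h ∘ᶠ K
row-·ᴹ L K false = refl
row-·ᴹ L K true  = refl

⟦∘ᶠ⟧ : ∀ f K a b → ⟦ f ∘ᶠ K ⟧ a b ≡ ⟦ f ⟧ (⟦ row K false ⟧ a b) (⟦ row K true ⟧ a b)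
⟦∘ᶠ⟧ (form α β) K a b = begin
  ⟦ α ·ᶠ K₀ +ᶠ β ·ᶠ K₁ ⟧ a b              ≡⟨ ⟦+ᶠ⟧ (α ·ᶠ K₀) (β ·ᶠ K₁) a b ⟩
  ⟦ α ·ᶠ K₀ ⟧ a b xor ⟦ β ·ᶠ K₁ ⟧ a b     ≡⟨ cong₂ _xor_ (⟦·ᶠ⟧ α K₀ a b) (⟦·ᶠ⟧ β K₁ a b) ⟩
  (α ∧ ⟦ K₀ ⟧ a b) xor (β ∧ ⟦ K₁ ⟧ a b)   ≡⟨ sym (⟦form⟧ α β _ _) ⟩
  ⟦ form α β ⟧ (⟦ K₀ ⟧ a b) (⟦ K₁ ⟧ a b)  ∎
  where
    open ≡-Reasoning
    K₀ = row K false
    K₁ = row K true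

1ᴹ swapᴹ plusᴹ dualᴹ : Mat
1ᴹ    = mat (form true false) (form false true)
swapᴹ = mat (form false true) (form true false)
plusᴹ = mat (form true false) (form true true)
dualᴹ = plusᴹ ·ᴹ (swapᴹ ·ᴹ plusᴹ)

combine : ∀ {n} → Form → SetSystem n → SetSystem n → SetSystem n
combine f N N' Z = ⟦ f ⟧ (N Z) (N' Z)

combine-cong : ∀ {n} f {N₀ N₀' N₁ N₁' : SetSystem n} → N₀ ≐ N₀' → N₁ ≐ N₁' →
  combine f N₀ N₁ ≐ combine f N₀' N₁'
combine-cong f e₀ e₁ Z = cong₂ ⟦ f ⟧ (e₀ Z) (e₁ Z)

linear-combine : ∀ {n} {F : SetSystem n → SetSystem n} → Linear F →
  ∀ f N N' → F (combine f N N') ≐ combine f (F N) (F N')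
linear-combine {F = F} linF (form false false) N N' Z = begin
  F (λ _ → false) Z    ≡⟨ cong-≐ linF (λ W → sym (xor-same (N W))) Z ⟩
  F (N ⊻ N) Z          ≡⟨ ⊻-homo linF N N Z ⟩
  F N Z xor F N Z      ≡⟨ xor-same (F N Z) ⟩
  false                ∎
  where open ≡-Reasoning
linear-combine linF (form true  false) N N' Z = refl
linear-combine linF (form false true ) N N' Z = refl
linear-combine linF (form true  true ) N N' Z = ⊻-homo linF N N' Z

fiber : ∀ {n} → SetSystem (suc n) → Bool → SetSystem n
fiber M h Z = M (h ∷ Z)

record Splits {n} (F : SetSystem (suc n) → SetSystem (suc n)) (K : Mat) (F' : SetSystem n → SetSystem n) : Set where
  field
    split : ∀ M h → fiber (F M) h ≐ combine (row K h) (F' (fiber M false)) (F' (fiber M true))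
open Splits

splits-∘ : ∀ {n} {F G : SetSystem (suc n) → SetSystem (suc n)} {F' G' : SetSystem n → SetSystem n} {K L} →
  Splits F K F' → Splits G L G' → Linear G' → Splits (λ M → G (F M)) (L ·ᴹ K) (λ N → G' (F' N))
splits-∘ {F = F} {G} {F'} {G'} {K} {L} splitF splitG linG' .split M h Z = begin
  fiber (G (F M)) h Z
    ≡⟨ split splitG (F M) h Z ⟩
  combine (row L h) (G' (fiber (F M) false)) (G' (fiber (F M) true)) Z
    ≡⟨ combine-cong (row L h) (through false) (through true) Z ⟩
  ⟦ row L h ⟧ (⟦ row K false ⟧ (GF₀ Z) (GF₁ Z)) (⟦ row K true ⟧ (GF₀ Z) (GF₁ Z))
    ≡⟨ sym (⟦∘ᶠ⟧ (row L h) K (GF₀ Z) (GF₁ Z)) ⟩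
  ⟦ row L h ∘ᶠ K ⟧ (GF₀ Z) (GF₁ Z)
    ≡⟨ cong (λ f → ⟦ f ⟧ (GF₀ Z) (GF₁ Z)) (sym (row-·ᴹ L K h)) ⟩
  combine (row (L ·ᴹ K) h) GF₀ GF₁ Z
    ∎
  where
    open ≡-Reasoning
    GF₀ = G' (F' (fiber M false))
    GF₁ = G' (F' (fiber M true))
    through : ∀ j → G' (fiber (F M) j) ≐ combine (row K j) GF₀ GF₁
    through j W = trans (cong-≐ linG' (split splitF M j) W) (linear-combine linG' (row K j) _ _ W)

splits-congʳ : ∀ {n} {F K} {F' F'' : SetSystem n → SetSystem n} →
  Splits F K F' → (∀ N → F' N ≐ F'' N) → Splits F K F''
splits-congʳ {K = K} splitF e .split M h Z =
  trans (split splitF M h Z) (combine-cong (row K h) (e (fiber M false)) (e (fiber M true)) Z)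

splits-id : ∀ {n} → Splits {n} (λ N → N) 1ᴹ (λ N → N)
splits-id .split M false Z = refl
splits-id .split M true  Z = refl

splits-⋆ : ∀ {n} x (X : Subset n) → Splits (λ N → N ⋆ (x ∷ X)) (if x then swapᴹ else 1ᴹ) (λ N → N ⋆ X)
splits-⋆ false X .split M false Z = refl
splits-⋆ false X .split M true  Z = refl
splits-⋆ true  X .split M false Z = refl
splits-⋆ true  X .split M true  Z = refl

splits-+-zero : ∀ {n} → Splits {n} (λ N → N + fz) plusᴹ (λ N → N)
splits-+-zero .split M false Z = xor-identityʳ _
splits-+-zero .split M true  Z =
  trans (cong (λ W → M (true ∷ Z) xor M (false ∷ W)) (p─⊥≡p Z)) (xor-comm (M (true ∷ Z)) (M (false ∷ Z)))

splits-+-suc : ∀ {n} (u : Fin n) → Splits (λ N → N + fs u) 1ᴹ (λ N → N + u)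
splits-+-suc u .split M false Z = refl
splits-+-suc u .split M true  Z = refl

splits-*̄-zero : ∀ {n} → Splits {n} (λ N → N *̄ fz) dualᴹ (λ N → N)
splits-*̄-zero = splits-congʳ
  (splits-∘ (splits-∘ splits-+-zero (splits-⋆ true Sub.⊥) (linear-⋆ Sub.⊥)) splits-+-zero linear-id)
  (λ N Z → cong N (⊕-identityʳ Z))

splits-*̄-suc : ∀ {n} (u : Fin n) → Splits (λ N → N *̄ fs u) 1ᴹ (λ N → N *̄ u)
splits-*̄-suc u =
  splits-∘ (splits-∘ (splits-+-suc u) (splits-⋆ false ⁅ u ⁆) (linear-⋆ ⁅ u ⁆)) (splits-+-suc u) (linear-+ u)

splits-foldr-fs : ∀ {n} (op : ∀ {m} → SetSystem m → Fin m → SetSystem m) →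
  (∀ {m} (u : Fin m) → Linear (λ N → op N u)) →
  (∀ {m} (u : Fin m) → Splits (λ N → op N (fs u)) 1ᴹ (λ N → op N u)) →
  ∀ x (X : Subset n) L →
  Splits (λ M → foldr (step op (x ∷ X)) M (map fs L)) 1ᴹ (λ M → foldr (step op X) M L)
splits-foldr-fs op linOp splitSuc x X [] = splits-id
splits-foldr-fs op linOp splitSuc x X (u ∷ L) with lookup X u
... | true  = splits-∘ (splits-foldr-fs op linOp splitSuc x X L) (splitSuc u) (linOp u)
... | false = splits-foldr-fs op linOp splitSuc x X L

splits-applyAll : ∀ {n} (op : ∀ {m} → SetSystem m → Fin m → SetSystem m) →
  (∀ {m} (u : Fin m) → Linear (λ N → op N u)) →
  (∀ {m} (u : Fin m) → Splits (λ N → op N (fs u)) 1ᴹ (λ N → op N u)) →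
  ∀ {K} → Splits {n} (λ N → op N fz) K (λ N → N) →
  ∀ x (X : Subset n) → Splits (λ M → applyAll op M (x ∷ X)) (if x then K ·ᴹ 1ᴹ else 1ᴹ) (λ M → applyAll op M X)
splits-applyAll {n} op linOp splitSuc splitZero true X =
  splits-∘ (splits-foldr-fs op linOp splitSuc true X (allFinL n)) splitZero linear-id
splits-applyAll {n} op linOp splitSuc splitZero false X = splits-foldr-fs op linOp splitSuc false X (allFinL n)

-- Words of operations

data Op (n : ℕ) : Set where
  +[_] ⋆[_] *̄[_] : Subset n → Op n

apply : ∀ {n} → SetSystem n → Op n → SetSystem n
apply M +[ X ] = M +ˢ X
apply M ⋆[ X ] = M ⋆ X
apply M *̄[ X ] = M *̄ˢ X

run : ∀ {n} → SetSystem n → List (Op n) → SetSystem n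
run = foldl apply

linear-apply : ∀ {n} (o : Op n) → Linear (λ M → apply M o)
linear-apply +[ X ] = linear-applyAll _+_ linear-+ X
linear-apply ⋆[ X ] = linear-⋆ X
linear-apply *̄[ X ] = linear-applyAll _*̄_ linear-*̄ X

linear-run : ∀ {n} (w : List (Op n)) → Linear (λ M → run M w)
linear-run [] = linear-id
linear-run (o ∷ w) = linear-∘ (linear-apply o) (linear-run w)

headMat : ∀ {n} → Op (suc n) → Mat
headMat +[ x ∷ X ] = if x then plusᴹ else 1ᴹ
headMat ⋆[ x ∷ X ] = if x then swapᴹ else 1ᴹ
headMat *̄[ x ∷ X ] = if x then dualᴹ else 1ᴹ

tailOp : ∀ {n} → Op (suc n) → Op n
tailOp +[ x ∷ X ] = +[ X ]
tailOp ⋆[ x ∷ X ] = ⋆[ X ]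
tailOp *̄[ x ∷ X ] = *̄[ X ]

splits-apply : ∀ {n} (o : Op (suc n)) → Splits (λ M → apply M o) (headMat o) (λ N → apply N (tailOp o))
splits-apply +[ x ∷ X ] = splits-applyAll _+_ linear-+ splits-+-suc splits-+-zero x X
splits-apply ⋆[ x ∷ X ] = splits-⋆ x X
splits-apply *̄[ x ∷ X ] = splits-applyAll _*̄_ linear-*̄ splits-*̄-suc splits-*̄-zero x X

wordMat : ∀ {n} → List (Op (suc n)) → Mat
wordMat [] = 1ᴹ
wordMat (o ∷ w) = wordMat w ·ᴹ headMat o

splits-run : ∀ {n} (w : List (Op (suc n))) → Splits (λ M → run M w) (wordMat w) (λ N → run N (map tailOp w))
splits-run [] = splits-id
splits-run (o ∷ w) = splits-∘ (splits-apply o) (splits-run w) (linear-run (map tailOp w))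

SameMatrices : ∀ {n} → List (Op n) → List (Op n) → Set
SameMatrices {zero}  v w = ⊤
SameMatrices {suc n} v w = wordMat v ≡ wordMat w × SameMatrices (map tailOp v) (map tailOp w)

run-cong : ∀ {n} (v w : List (Op n)) → SameMatrices v w → ∀ M → run M v ≐ run M w
run-cong {zero} v w _ M [] = trans (run-empty v M) (sym (run-empty w M))
  where
    run-empty : ∀ (w : List (Op 0)) M → run M w [] ≡ M []
    run-empty [] M = refl
    run-empty (+[ [] ] ∷ w) M = run-empty w M
    run-empty (⋆[ [] ] ∷ w) M = run-empty w (M ⋆ [])
    run-empty (*̄[ [] ] ∷ w) M = run-empty w M
run-cong {suc n} v w (same-head , same-tail) M (h ∷ Z) = begin
  run M v (h ∷ Z)                                           ≡⟨ split (splits-run v) M h Z ⟩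
  combine (row (wordMat v) h) (run M₀ v') (run M₁ v') Z     ≡⟨ cong (λ K → combine (row K h) (run M₀ v') (run M₁ v') Z) same-head ⟩
  combine (row (wordMat w) h) (run M₀ v') (run M₁ v') Z     ≡⟨ combine-cong (row (wordMat w) h) (run-cong v' w' same-tail M₀) (run-cong v' w' same-tail M₁) Z ⟩
  combine (row (wordMat w) h) (run M₀ w') (run M₁ w') Z     ≡⟨ sym (split (splits-run w) M h Z) ⟩
  run M w (h ∷ Z)                                           ∎
  where
    open ≡-Reasoning
    M₀ = fiber M false
    M₁ = fiber M true
    v' = map tailOp v
    w' = map tailOp w

data Partition : ∀ {n} → Subset n → Subset n → Subset n → Set where
  []  : Partition [] [] []
  inA : ∀ {n} {A B C : Subset n} → Partition A B C → Partition (true ∷ A) (false ∷ B) (false ∷ C)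
  inB : ∀ {n} {A B C : Subset n} → Partition A B C → Partition (false ∷ A) (true ∷ B) (false ∷ C)
  inC : ∀ {n} {A B C : Subset n} → Partition A B C → Partition (false ∷ A) (false ∷ B) (true ∷ C)

-- Elementwise these are relations between +u, *u and *̄u such as (+u)(*̄u) = (*u)(+u).
sameMatrices-+ˢ : ∀ {n} (Y : Subset n) {A B C} → Partition A B C →
  SameMatrices (+[ Y ] ∷ ⋆[ B ⊕ (Y ─ A) ] ∷ *̄[ C ⊕ (Y ─ A) ] ∷ []) (⋆[ B ] ∷ *̄[ C ] ∷ +[ Y ] ∷ [])
sameMatrices-+ˢ []          []      = tt
sameMatrices-+ˢ (false ∷ Y) (inA p) = refl , sameMatrices-+ˢ Y p
sameMatrices-+ˢ (true  ∷ Y) (inA p) = refl , sameMatrices-+ˢ Y p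
sameMatrices-+ˢ (false ∷ Y) (inB p) = refl , sameMatrices-+ˢ Y p
sameMatrices-+ˢ (true  ∷ Y) (inB p) = refl , sameMatrices-+ˢ Y p
sameMatrices-+ˢ (false ∷ Y) (inC p) = refl , sameMatrices-+ˢ Y p
sameMatrices-+ˢ (true  ∷ Y) (inC p) = refl , sameMatrices-+ˢ Y p

sameMatrices-*̄ˢ : ∀ {n} (Y : Subset n) {A B C} → Partition A B C →
  SameMatrices (*̄[ Y ] ∷ ⋆[ B ] ∷ *̄[ C ⊕ (Y ─ B) ] ∷ []) (⋆[ B ] ∷ *̄[ C ] ∷ +[ Y ∩ B ] ∷ [])
sameMatrices-*̄ˢ []          []      = tt
sameMatrices-*̄ˢ (false ∷ Y) (inA p) = refl , sameMatrices-*̄ˢ Y p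
sameMatrices-*̄ˢ (true  ∷ Y) (inA p) = refl , sameMatrices-*̄ˢ Y p
sameMatrices-*̄ˢ (false ∷ Y) (inB p) = refl , sameMatrices-*̄ˢ Y p
sameMatrices-*̄ˢ (true  ∷ Y) (inB p) = refl , sameMatrices-*̄ˢ Y p
sameMatrices-*̄ˢ (false ∷ Y) (inC p) = refl , sameMatrices-*̄ˢ Y p
sameMatrices-*̄ˢ (true  ∷ Y) (inC p) = refl , sameMatrices-*̄ˢ Y p

sameMatrices-⋆ : ∀ {n} (Y : Subset n) {A B C} → Partition A B C →
  SameMatrices (⋆[ Y ] ∷ ⋆[ B ⊕ (Y ─ C) ] ∷ *̄[ C ] ∷ []) (⋆[ B ] ∷ *̄[ C ] ∷ +[ Y ∩ C ] ∷ [])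
sameMatrices-⋆ []          []      = tt
sameMatrices-⋆ (false ∷ Y) (inA p) = refl , sameMatrices-⋆ Y p
sameMatrices-⋆ (true  ∷ Y) (inA p) = refl , sameMatrices-⋆ Y p
sameMatrices-⋆ (false ∷ Y) (inB p) = refl , sameMatrices-⋆ Y p
sameMatrices-⋆ (true  ∷ Y) (inB p) = refl , sameMatrices-⋆ Y p
sameMatrices-⋆ (false ∷ Y) (inC p) = refl , sameMatrices-⋆ Y p
sameMatrices-⋆ (true  ∷ Y) (inC p) = refl , sameMatrices-⋆ Y p

-- The minimum size of a member

IsMinSize : ∀ {n} → SetSystem n → ℕ → Set
IsMinSize {n} N m = (Σ (Subset n) λ Z → N Z ≡ true × ∣ Z ∣ ≡ m) × (∀ Z → N Z ≡ true → m ≤ ∣ Z ∣)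

isMinSize-≐ : ∀ {n} {N N' : SetSystem n} {m} → N ≐ N' → IsMinSize N m → IsMinSize N' m
isMinSize-≐ e ((Z , Z∈N , ∣Z∣≡m) , minimal) =
  (Z , trans (sym (e Z)) Z∈N , ∣Z∣≡m) , λ W W∈N' → minimal W (trans (e W) W∈N')

isMinSize-unique : ∀ {n} {N : SetSystem n} {m k} → IsMinSize N m → IsMinSize N k → m ≡ k
isMinSize-unique ((Z , Z∈N , ∣Z∣≡m) , minimal-m) ((W , W∈N , ∣W∣≡k) , minimal-k) =
  ≤-antisym (subst (_ ≤_) ∣W∣≡k (minimal-m W W∈N)) (subst (_ ≤_) ∣Z∣≡m (minimal-k Z Z∈N))

isMinSize⇒proper : ∀ {n} {N : SetSystem n} {m} → IsMinSize N m → Proper N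
isMinSize⇒proper ((Z , Z∈N , _) , _) = Z , Z∈N

minimum-≤ : ∀ {x} {xs} → x ∈ xs → minimum xs ≤ x
minimum-≤ {xs = x ∷ []}     (here refl) = ≤-refl
minimum-≤ {xs = x ∷ y ∷ xs} (here refl) = m⊓n≤m x _
minimum-≤ {xs = x ∷ y ∷ xs} (there p)   = ≤-trans (m⊓n≤n x _) (minimum-≤ p)

minimum-∷-∈ : ∀ x xs → minimum (x ∷ xs) ∈ x ∷ xs
minimum-∷-∈ x []       = here refl
minimum-∷-∈ x (y ∷ xs) with ⊓-sel x (minimum (y ∷ xs))
... | inj₁ eq = here eq
... | inj₂ eq = there (subst (_∈ y ∷ xs) (sym eq) (minimum-∷-∈ y xs))

minimum-∈ : ∀ {x} {xs} → x ∈ xs → minimum xs ∈ xs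
minimum-∈ {xs = y ∷ ys} _ = minimum-∷-∈ y ys

∈-allSubsets : ∀ {n} (Z : Subset n) → Z ∈ allSubsets n
∈-allSubsets []          = here refl
∈-allSubsets (true ∷ Z)  = ∈-++⁺ˡ (∈-map⁺ (true ∷_) (∈-allSubsets Z))
∈-allSubsets (false ∷ Z) = ∈-++⁺ʳ (map (true ∷_) (allSubsets _)) (∈-map⁺ (false ∷_) (∈-allSubsets Z))

d-isMinSize : ∀ {n} {N : SetSystem n} → Proper N → IsMinSize N (d N)
d-isMinSize {n} {N} (Z , Z∈N) = attained , minimal
  where
    size : Subset n → ℕ
    size W = ∣ Sub.⊥ ⊕ W ∣
    sizes : ∀ {W} → N W ≡ true → size W ∈ map size (filter (λ W → N W ≟B true) (allSubsets n))
    sizes {W} W∈N = ∈-map∘filter⁺ size (λ W → N W ≟B true) (W , ∈-allSubsets W , refl , W∈N)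
    attained : Σ (Subset n) λ W → N W ≡ true × ∣ W ∣ ≡ d N
    attained with ∈-map∘filter⁻ size (λ W → N W ≟B true) {xs = allSubsets n} (minimum-∈ (sizes Z∈N))
    ... | W , _ , d≡size , W∈N = W , W∈N , trans (cong ∣_∣ (sym (⊕-identityˡ W))) (sym d≡size)
    minimal : ∀ W → N W ≡ true → d N ≤ ∣ W ∣
    minimal W W∈N = subst (d N ≤_) (cong ∣_∣ (⊕-identityˡ W)) (minimum-≤ (sizes W∈N))

d-unique : ∀ {n} {N : SetSystem n} {m} → IsMinSize N m → d N ≡ m
d-unique isMin = isMinSize-unique (d-isMinSize (isMinSize⇒proper isMin)) isMin

applyAll-preserves : ∀ {n} {op : SetSystem n → Fin n → SetSystem n} (P : SetSystem n → Set) →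
  (∀ {N} u → P N → P (op N u)) → ∀ X {N} → P N → P (applyAll op N X)
applyAll-preserves {n} {op} P preserves X = go (allFinL n)
  where
    go : ∀ L {N} → P N → P (foldr (step op X) N L)
    go [] p = p
    go (u ∷ L) p with lookup X u
    ... | true  = preserves u (go L p)
    ... | false = go L p

xor-∧≡true⁺ : ∀ a b c → a ≡ true → (b ≡ true → c ≡ true → ⊥) → a xor (b ∧ c) ≡ true
xor-∧≡true⁺ true false c     _ _      = refl
xor-∧≡true⁺ true true  false _ _      = refl
xor-∧≡true⁺ true true  true  _ contra = ⊥-elim (contra refl refl)

xor-∧≡true⁻ : ∀ a b c → a xor (b ∧ c) ≡ true → a ≡ true ⊎ (b ≡ true × c ≡ true)
xor-∧≡true⁻ true  false c     _ = inj₁ refl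
xor-∧≡true⁻ true  true  false _ = inj₁ refl
xor-∧≡true⁻ false true  true  _ = inj₂ (refl , refl)
xor-∧≡true⁻ true  true  true  ()
xor-∧≡true⁻ false false c     ()
xor-∧≡true⁻ false true  false ()

-- N + u only adds or removes sets W ∋ u with W - u ∈ N, and these are larger than a minimal member.
isMinSize-+ : ∀ {n} {N : SetSystem n} {m} (u : Fin n) → IsMinSize N m → IsMinSize (N + u) m
isMinSize-+ {N = N} {m} u ((Z , Z∈N , ∣Z∣≡m) , minimal) = (Z , Z∈N+u , ∣Z∣≡m) , minimal′
  where
    larger : ∀ {W} → lookup W u ≡ true → N (W - u) ≡ true → m < ∣ W ∣
    larger {W} u∈W W-u∈N = ≤-<-trans (minimal (W - u) W-u∈N) (x∈p⇒∣p-x∣<∣p∣ (lookup⇒[]= u W u∈W))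
    Z∈N+u : (N + u) Z ≡ true
    Z∈N+u = xor-∧≡true⁺ (N Z) (lookup Z u) (N (Z - u)) Z∈N
      (λ u∈Z Z-u∈N → <-irrefl (sym ∣Z∣≡m) (larger u∈Z Z-u∈N))
    minimal′ : ∀ W → (N + u) W ≡ true → m ≤ ∣ W ∣
    minimal′ W W∈N+u with xor-∧≡true⁻ (N W) (lookup W u) (N (W - u)) W∈N+u
    ... | inj₁ W∈N             = minimal W W∈N
    ... | inj₂ (u∈W , W-u∈N)   = <⇒≤ (larger u∈W W-u∈N)

isMinSize-+ˢ : ∀ {n} {N : SetSystem n} {m} (W : Subset n) → IsMinSize N m → IsMinSize (N +ˢ W) m
isMinSize-+ˢ {m = m} W = applyAll-preserves (λ N → IsMinSize N m) isMinSize-+ W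

proper-+ : ∀ {n} {N : SetSystem n} (u : Fin n) → Proper N → Proper (N + u)
proper-+ u proper = isMinSize⇒proper (isMinSize-+ u (d-isMinSize proper))

proper-⋆ : ∀ {n} {N : SetSystem n} (X : Subset n) → Proper N → Proper (N ⋆ X)
proper-⋆ {N = N} X (Z , Z∈N) = Z ⊕ X , trans (cong N (⊕-cancelʳ Z X)) Z∈N

proper-*̄ : ∀ {n} {N : SetSystem n} (u : Fin n) → Proper N → Proper (N *̄ u)
proper-*̄ u proper = proper-+ u (proper-⋆ ⁅ u ⁆ (proper-+ u proper))

proper-*̄ˢ : ∀ {n} {N : SetSystem n} (X : Subset n) → Proper N → Proper (N *̄ˢ X)
proper-*̄ˢ X = applyAll-preserves Proper proper-*̄ X

d-run : ∀ {n} {M : SetSystem n} {B C W : Subset n} {w} → Proper M →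
  SameMatrices w (⋆[ B ] ∷ *̄[ C ] ∷ +[ W ] ∷ []) → d (run M w) ≡ d (M ⋆ B *̄ˢ C)
d-run {M = M} {B} {C} {W} {w} proper same =
  d-unique (isMinSize-≐ (≐-sym (run-cong w _ same M))
    (isMinSize-+ˢ W (d-isMinSize (proper-*̄ˢ C (proper-⋆ B proper)))))

-- Sums over ordered partitions

module InterlaceSums {c ℓ : Level} (R : CommutativeRing c ℓ) where
  open CommutativeRing R renaming (_+_ to _+R_; _*_ to _*R_; refl to ≈-refl; sym to ≈-sym; trans to ≈-trans)
  open CommutativeSemigroupProperties +-commutativeSemigroup using (x∙yz≈x∙zy; x∙yz≈y∙xz; x∙yz≈z∙yx)
  open import Relation.Binary.Reasoning.Setoid setoid

  Summand : ℕ → Set c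
  Summand n = Subset n → Subset n → Subset n → Carrier

  split₃ : ∀ {n} → Summand (suc n) → Summand n
  split₃ f A B C =
    f (true ∷ A) (false ∷ B) (false ∷ C) +R (f (false ∷ A) (true ∷ B) (false ∷ C) +R f (false ∷ A) (false ∷ B) (true ∷ C))

  sumList : ∀ {n} → Summand n → List (Subset n × Subset n × Subset n) → Carrier
  sumList f = foldr (λ { (A , B , C) s → f A B C +R s }) 0#

  extend : ∀ {n} → Subset n × Subset n × Subset n → List (Subset (suc n) × Subset (suc n) × Subset (suc n))
  extend (A , B , C) =
    (true ∷ A , false ∷ B , false ∷ C) ∷ (false ∷ A , true ∷ B , false ∷ C) ∷ (false ∷ A , false ∷ B , true ∷ C) ∷ []

  sumP3-suc : ∀ {n} (f : Summand (suc n)) → sumP3 R f ≈ sumP3 R (split₃ f)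
  sumP3-suc {n} f = go (P3 n)
    where
      go : ∀ xs → sumList f (concatMap extend xs) ≈ sumList (split₃ f) xs
      go [] = ≈-refl
      go ((A , B , C) ∷ xs) = begin
        a +R (b +R (e +R sumList f (concatMap extend xs))) ≈⟨ +-congˡ (+-congˡ (+-congˡ (go xs))) ⟩
        a +R (b +R (e +R sumList (split₃ f) xs))           ≈⟨ +-congˡ (+-assoc b e _) ⟨
        a +R ((b +R e) +R sumList (split₃ f) xs)           ≈⟨ +-assoc a (b +R e) _ ⟨
        split₃ f A B C +R sumList (split₃ f) xs            ∎
        where
          a = f (true ∷ A) (false ∷ B) (false ∷ C)
          b = f (false ∷ A) (true ∷ B) (false ∷ C)
          e = f (false ∷ A) (false ∷ B) (true ∷ C)

  sumP3-cong : ∀ {n} {f g : Summand n} → (∀ {A B C} → Partition A B C → f A B C ≈ g A B C) →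
    sumP3 R f ≈ sumP3 R g
  sumP3-cong {zero}          f≈g = +-congʳ (f≈g [])
  sumP3-cong {suc n} {f} {g} f≈g = begin
    sumP3 R f           ≈⟨ sumP3-suc f ⟩
    sumP3 R (split₃ f)  ≈⟨ sumP3-cong (λ p → +-cong (f≈g (inA p)) (+-cong (f≈g (inB p)) (f≈g (inC p)))) ⟩
    sumP3 R (split₃ g)  ≈⟨ sumP3-suc g ⟨
    sumP3 R g           ∎

  sumP3-reindex : (T : ∀ {m} → Subset m → Summand m → Summand m) →
    (∀ f → T [] f [] [] [] ≈ f [] [] []) →
    (∀ {m} y (Y : Subset m) f A B C → T Y (split₃ f) A B C ≈ split₃ (T (y ∷ Y) f) A B C) →
    ∀ {n} (Y : Subset n) f → sumP3 R f ≈ sumP3 R (T Y f)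
  sumP3-reindex T base local [] f = +-congʳ (≈-sym (base f))
  sumP3-reindex T base local (y ∷ Y) f = begin
    sumP3 R f                       ≈⟨ sumP3-suc f ⟩
    sumP3 R (split₃ f)              ≈⟨ sumP3-reindex T base local Y (split₃ f) ⟩
    sumP3 R (T Y (split₃ f))        ≈⟨ sumP3-cong (λ {A} {B} {C} _ → local y Y f A B C) ⟩
    sumP3 R (split₃ (T (y ∷ Y) f))  ≈⟨ sumP3-suc (T (y ∷ Y) f) ⟨
    sumP3 R (T (y ∷ Y) f)           ∎

  sumP3-transpose-BC : ∀ {n} (Y : Subset n) f → sumP3 R f ≈ sumP3 R (λ A B C → f A (B ⊕ (Y ─ A)) (C ⊕ (Y ─ A)))
  sumP3-transpose-BC = sumP3-reindex (λ Y f A B C → f A (B ⊕ (Y ─ A)) (C ⊕ (Y ─ A))) (λ _ → ≈-refl) λ where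
    false Y f A B C → ≈-refl
    true  Y f A B C → x∙yz≈x∙zy _ _ _

  sumP3-transpose-AC : ∀ {n} (Y : Subset n) f → sumP3 R f ≈ sumP3 R (λ A B C → f (A ⊕ (Y ─ B)) B (C ⊕ (Y ─ B)))
  sumP3-transpose-AC = sumP3-reindex (λ Y f A B C → f (A ⊕ (Y ─ B)) B (C ⊕ (Y ─ B))) (λ _ → ≈-refl) λ where
    false Y f A B C → ≈-refl
    true  Y f A B C → x∙yz≈z∙yx _ _ _

  sumP3-transpose-AB : ∀ {n} (Y : Subset n) f → sumP3 R f ≈ sumP3 R (λ A B C → f (A ⊕ (Y ─ C)) (B ⊕ (Y ─ C)) C)
  sumP3-transpose-AB = sumP3-reindex (λ Y f A B C → f (A ⊕ (Y ─ C)) (B ⊕ (Y ─ C)) C) (λ _ → ≈-refl) λ where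
    false Y f A B C → ≈-refl
    true  Y f A B C → x∙yz≈y∙xz _ _ _

  sumP3-pow-d-cong : ∀ {n} {coef : Summand n} {N N' : Subset n → Subset n → Subset n → SetSystem n} {y} →
    (∀ {A B C} → Partition A B C → d (N A B C) ≡ d (N' A B C)) →
    sumP3 R (λ A B C → coef A B C *R pow R y (d (N A B C))) ≈ sumP3 R (λ A B C → coef A B C *R pow R y (d (N' A B C)))
  sumP3-pow-d-cong {coef = coef} {y = y} d≡ = sumP3-cong λ {A} {B} {C} p →
    reflexive (cong (λ k → coef A B C *R pow R y k) (d≡ p))

theorem7 : ∀ {c ℓ : Level} (R : CommutativeRing c ℓ) (n : ℕ) (M : SetSystem n) (Y : Subset n) →
    Proper M →
    let open CommutativeRing R in
    ∀ (a b cc : Subset n → Carrier) (y : Carrier) →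
    (Q R a b cc y (M +ˢ Y) ≈ sumP3 R (λ A B C → a A * b (B ⊕ (Y ─ A)) * cc (C ⊕ (Y ─ A)) * pow R y (d (M ⋆ B *̄ˢ C))))
    × (Q R a b cc y (M *̄ˢ Y) ≈ sumP3 R (λ A B C → a (A ⊕ (Y ─ B)) * b B * cc (C ⊕ (Y ─ B)) * pow R y (d (M ⋆ B *̄ˢ C))))
    × (Q R a b cc y (M ⋆ Y) ≈ sumP3 R (λ A B C → a (A ⊕ (Y ─ C)) * b (B ⊕ (Y ─ C)) * cc C * pow R y (d (M ⋆ B *̄ˢ C))))
theorem7 R n M Y proper a b cc y =
    ≈-trans (sumP3-transpose-BC Y _) (sumP3-pow-d-cong λ p → d-run proper (sameMatrices-+ˢ Y p))
  , ≈-trans (sumP3-transpose-AC Y _) (sumP3-pow-d-cong λ p → d-run proper (sameMatrices-*̄ˢ Y p))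
  , ≈-trans (sumP3-transpose-AB Y _) (sumP3-pow-d-cong λ p → d-run proper (sameMatrices-⋆ Y p))
  where
    open CommutativeRing R using () renaming (trans to ≈-trans)
    open InterlaceSums R
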